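{- Let $G$ be a matroid on $[n]$ with no loops and no multiple points. Suppose every flat $X$ of $G$ has a basis (an independent subset of $X$ of size $\operatorname{rk}(X)$) whose line-closure is equal to $X$. Then $G$ is locally taut.
   Context: $\operatorname{cl}$ is matroid closure; a set $S$ is line-closed if $\operatorname{cl}(\{i,j\})\subseteq S$ for all $i,j\in S$, and the line-closure of $S$ is the intersection of all line-closed sets containing $S$. For matroids $H,H'$ on the same ground set $E$, $H$ is a quotient of $H'$ if every flat of $H$ is a flat of $H'$. The truncation $H^{[3]}$ has as dependent sets those of $H$ together with all subsets of size greater than 3. $H$ is taut if $H$ is not a quotient of any matroid $H'\neq H$ on $E$ with $(H')^{[3]}=H^{[3]}$. $G$ is locally taut if the restriction $G|X$ of $G$ to every flat $X$ (the matroid on ground set $X$ whose dependent sets are the dependent sets of $G$ contained in $X$) is taut. -}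

module Defs where

open import Data.Nat using (ℕ; zero; suc; _⊔_; _<_; _≤ᵇ_)
open import Data.Bool using (Bool; true; false; _∧_; if_then_else_)
open import Data.Fin using (Fin)
open import Data.Fin.Subset using (Subset; _∈_; _∉_; _⊆_; _∪_; ⁅_⁆; ∣_∣; ⊤; ⊥)
open import Data.Fin.Subset.Properties using (_⊆?_)
open import Data.Vec using (_∷_; [])
open import Data.List using (List; _++_; map; foldr; [_])
open import Data.Product using (Σ; ∃; _×_)
open import Relation.Nullary using (¬_)
open import Relation.Nullary.Decidable using (⌊_⌋)
open import Relation.Binary.PropositionalEquality using (_≡_; _≢_)

record SetSystem (n : ℕ) : Set where
  field
    ground : Subset n
    indep  : Subset n → Bool
open SetSystem public

Indep : ∀ {n} → SetSystem n → Subset n → Set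
Indep M I = indep M I ≡ true

record IsMatroid {n : ℕ} (M : SetSystem n) : Set where
  field
    indep⊆ground : ∀ I → Indep M I → I ⊆ ground M
    indep-∅      : Indep M ⊥
    hereditary   : ∀ I J → I ⊆ J → Indep M J → Indep M I
    exchange     : ∀ I J → Indep M I → Indep M J → ∣ I ∣ < ∣ J ∣ →
                   ∃ λ x → x ∈ J × x ∉ I × Indep M (I ∪ ⁅ x ⁆)

allSubsets : (n : ℕ) → List (Subset n)
allSubsets zero    = [ [] ]
allSubsets (suc n) = map (false ∷_) (allSubsets n) ++ map (true ∷_) (allSubsets n)

rk : ∀ {n} → SetSystem n → Subset n → ℕ
rk {n} M X = foldr (λ I acc → (if indep M I ∧ ⌊ I ⊆? X ⌋ then ∣ I ∣ else 0) ⊔ acc) 0 (allSubsets n)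

_∈cl[_]_ : ∀ {n} → Fin n → SetSystem n → Subset n → Set
x ∈cl[ M ] Y = x ∈ ground M × rk M (Y ∪ ⁅ x ⁆) ≡ rk M Y

Flat : ∀ {n} → SetSystem n → Subset n → Set
Flat M X = X ⊆ ground M × (∀ x → x ∈cl[ M ] X → x ∈ X)

IsBasisOf : ∀ {n} → SetSystem n → Subset n → Subset n → Set
IsBasisOf M B X = Indep M B × B ⊆ X × ∣ B ∣ ≡ rk M X

LineClosed : ∀ {n} → SetSystem n → Subset n → Set
LineClosed M S = ∀ i j → i ∈ S → j ∈ S → ∀ x → x ∈cl[ M ] (⁅ i ⁆ ∪ ⁅ j ⁆) → x ∈ S

_∈lcl[_]_ : ∀ {n} → Fin n → SetSystem n → Subset n → Set
x ∈lcl[ M ] S = ∀ T → T ⊆ ground M → LineClosed M T → S ⊆ T → x ∈ T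

LineClosureIs : ∀ {n} → SetSystem n → Subset n → Subset n → Set
LineClosureIs M S X = ∀ x → (x ∈ X → x ∈lcl[ M ] S) × (x ∈lcl[ M ] S → x ∈ X)

NoLoops : ∀ {n} → SetSystem n → Set
NoLoops M = ∀ x → x ∈ ground M → Indep M ⁅ x ⁆

NoMultiplePoints : ∀ {n} → SetSystem n → Set
NoMultiplePoints M = ∀ x y → x ∈ ground M → y ∈ ground M → x ≢ y → Indep M (⁅ x ⁆ ∪ ⁅ y ⁆)

IsQuotientOf : ∀ {n} → SetSystem n → SetSystem n → Set
IsQuotientOf H H' = ∀ X → Flat H X → Flat H' X

truncIndep : ∀ {n} → SetSystem n → Subset n → Bool
truncIndep M I = indep M I ∧ (∣ I ∣ ≤ᵇ 3)

SameTruncation3 : ∀ {n} → SetSystem n → SetSystem n → Set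
SameTruncation3 H H' = ∀ I → truncIndep H I ≡ truncIndep H' I

SameMatroid : ∀ {n} → SetSystem n → SetSystem n → Set
SameMatroid H H' = ∀ I → indep H I ≡ indep H' I

Taut : ∀ {n} → SetSystem n → Set
Taut {n} H = (H' : SetSystem n) → IsMatroid H' → ground H' ≡ ground H →
             IsQuotientOf H H' → SameTruncation3 H H' → SameMatroid H H'

restrict : ∀ {n} → SetSystem n → Subset n → SetSystem n
restrict G X = record { ground = X ; indep = λ I → indep G I ∧ ⌊ I ⊆? X ⌋ }

LocallyTaut : ∀ {n} → SetSystem n → Set
LocallyTaut G = ∀ X → Flat G X → Taut (restrict G X)

{-# OPTIONS --safe #-}
-- Fix a flat X, put H = G|X, and let H' be a matroid on X of which H is a
-- quotient and which has the same truncation H^[3].  Since H-flats are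
-- H'-flats, H'-closures lie inside H-closures, which forces every H-independent
-- set to be H'-independent.  Conversely let I be H'-independent, Y = cl_G(I),
-- and B a basis of Y whose line-closure is Y.  The H'-closure T of B is
-- line-closed in G: two points of T are independent (G is simple) and a third
-- point on their line makes a dependent triple of H, hence of H', so it stays
-- in T.  Thus I ⊆ Y ⊆ T and |I| ≤ rk_H'(T) ≤ |B| = rk_G(Y) = rk_G(I), so I is
-- independent in G.
module Submission where

open import Defs
open import Data.Nat using (ℕ)
open import Data.Fin.Subset using (⊤)
open import Data.Product using (∃; _×_)
open import Relation.Binary.PropositionalEquality using (_≡_)

open import Data.Bool using (Bool; true; false; _∧_; if_then_else_)
open import Data.Bool.Properties using (∧-conicalˡ; T-≡)
open import Data.Fin using (Fin) renaming (_≟_ to _≟ᶠ_)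
open import Data.Fin.Subset using (Subset; _∈_; _∉_; _⊆_; _∪_; ⁅_⁆; ∣_∣; ⊥)
open import Data.Fin.Subset.Properties
  using (_⊆?_; _∈?_; ⊥⊆; ∣⊥∣≡0; x∈⁅y⁆⇒x≡y; ∣⁅x⁆∣≡1; ⊆-refl; ⊆-trans; ∪-idem;
         p⊆q⇒∣p∣≤∣q∣; p⊂q⇒∣p∣<∣q∣; p⊆p∪q; q⊆p∪q; x∈p∪q⁻; x∈p∪q⁺; x∈⁅x⁆)
open import Data.List using (foldr; map)
import Data.List as List
open import Data.List.Relation.Unary.Any using (here; there)
open import Data.List.Membership.Propositional using () renaming (_∈_ to _∈ₗ_)
open import Data.List.Membership.Propositional.Properties using (∈-map⁺; ∈-++⁺ˡ; ∈-++⁺ʳ)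
open import Data.Nat using (zero; suc; _+_; _≤_; _<_; _⊔_; z≤n; s≤s; _≤?_) renaming (_≟_ to _≟ℕ_)
open import Data.Nat.Properties
  using (≤-antisym; ≤-trans; ≤-reflexive; n≤1+n; +-suc; +-identityʳ; +-monoʳ-≤; +-monoˡ-≤;
         m≤n+m; m≤m⊔n; m≤n⇒m≤o⊔n; ⊔-sel; ≤⇒≯; ≰⇒>; ≤⇒≤ᵇ; module ≤-Reasoning)
open import Data.Product using (_,_; proj₁; proj₂)
open import Data.Sum using (_⊎_; inj₁; inj₂)
open import Data.Vec using (_∷_; []; tabulate)
open import Data.Vec.Properties using (lookup∘tabulate; []=⇒lookup; lookup⇒[]=)
open import Function.Bundles using (Equivalence)
open import Relation.Nullary using (Dec; yes; no; does; contradiction)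
open import Relation.Nullary.Decidable using (⌊_⌋; dec-true; _×-dec_)
open import Relation.Binary.PropositionalEquality using (refl; sym; trans; cong₂; subst)

private
  variable
    n : ℕ

≡true-equiv⇒≡ : ∀ {a b : Bool} → (a ≡ true → b ≡ true) → (b ≡ true → a ≡ true) → a ≡ b
≡true-equiv⇒≡ {true}  {true}  _ _ = refl
≡true-equiv⇒≡ {true}  {false} f _ = sym (f refl)
≡true-equiv⇒≡ {false} {true}  _ g = g refl
≡true-equiv⇒≡ {false} {false} _ _ = refl

does≡true⇒ : ∀ {P : Set} (P? : Dec P) → does P? ≡ true → P
does≡true⇒ (yes p) _ = p

module _ {p q r : Subset n} where

  ∪-least : p ⊆ r → q ⊆ r → p ∪ q ⊆ r
  ∪-least p⊆r q⊆r {x} x∈p∪q with x∈p∪q⁻ p q x∈p∪q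
  ... | inj₁ x∈p = p⊆r x∈p
  ... | inj₂ x∈q = q⊆r x∈q

x∈p⇒⁅x⁆⊆p : ∀ {x : Fin n} {p} → x ∈ p → ⁅ x ⁆ ⊆ p
x∈p⇒⁅x⁆⊆p {x = x} {p} x∈p y∈⁅x⁆ = subst (_∈ p) (sym (x∈⁅y⁆⇒x≡y x y∈⁅x⁆)) x∈p

x∉p⇒∣p∣<∣p∪⁅x⁆∣ : ∀ {x : Fin n} {p} → x ∉ p → ∣ p ∣ < ∣ p ∪ ⁅ x ⁆ ∣
x∉p⇒∣p∣<∣p∪⁅x⁆∣ {x = x} x∉p = p⊂q⇒∣p∣<∣q∣ (p⊆p∪q ⁅ x ⁆ , x , x∈p∪q⁺ (inj₂ (x∈⁅x⁆ x)) , x∉p)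

p⊆q⇒∣q∣≤∣p∣⇒q⊆p : ∀ {p q : Subset n} → p ⊆ q → ∣ q ∣ ≤ ∣ p ∣ → q ⊆ p
p⊆q⇒∣q∣≤∣p∣⇒q⊆p {p = p} p⊆q ∣q∣≤∣p∣ {x} x∈q with x ∈? p
... | yes x∈p = x∈p
... | no x∉p  = contradiction (p⊂q⇒∣p∣<∣q∣ (p⊆q , x , x∈q , x∉p)) (≤⇒≯ ∣q∣≤∣p∣)

∣p∪q∣≤∣p∣+∣q∣ : ∀ (p q : Subset n) → ∣ p ∪ q ∣ ≤ ∣ p ∣ + ∣ q ∣
∣p∪q∣≤∣p∣+∣q∣ []          []          = z≤n
∣p∪q∣≤∣p∣+∣q∣ (true ∷ p)  (true ∷ q)  = s≤s (≤-trans (∣p∪q∣≤∣p∣+∣q∣ p q) (+-monoʳ-≤ ∣ p ∣ (n≤1+n ∣ q ∣)))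
∣p∪q∣≤∣p∣+∣q∣ (true ∷ p)  (false ∷ q) = s≤s (∣p∪q∣≤∣p∣+∣q∣ p q)
∣p∪q∣≤∣p∣+∣q∣ (false ∷ p) (true ∷ q)  = ≤-trans (s≤s (∣p∪q∣≤∣p∣+∣q∣ p q)) (≤-reflexive (sym (+-suc ∣ p ∣ ∣ q ∣)))
∣p∪q∣≤∣p∣+∣q∣ (false ∷ p) (false ∷ q) = ∣p∪q∣≤∣p∣+∣q∣ p q

∣⁅i⁆∪⁅j⁆∪⁅k⁆∣≤3 : ∀ (i j k : Fin n) → ∣ (⁅ i ⁆ ∪ ⁅ j ⁆) ∪ ⁅ k ⁆ ∣ ≤ 3
∣⁅i⁆∪⁅j⁆∪⁅k⁆∣≤3 i j k = begin
  ∣ (⁅ i ⁆ ∪ ⁅ j ⁆) ∪ ⁅ k ⁆ ∣          ≤⟨ ∣p∪q∣≤∣p∣+∣q∣ (⁅ i ⁆ ∪ ⁅ j ⁆) ⁅ k ⁆ ⟩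
  ∣ ⁅ i ⁆ ∪ ⁅ j ⁆ ∣ + ∣ ⁅ k ⁆ ∣         ≤⟨ +-monoˡ-≤ ∣ ⁅ k ⁆ ∣ (∣p∪q∣≤∣p∣+∣q∣ ⁅ i ⁆ ⁅ j ⁆) ⟩
  (∣ ⁅ i ⁆ ∣ + ∣ ⁅ j ⁆ ∣) + ∣ ⁅ k ⁆ ∣  ≡⟨ cong₂ _+_ (cong₂ _+_ (∣⁅x⁆∣≡1 i) (∣⁅x⁆∣≡1 j)) (∣⁅x⁆∣≡1 k) ⟩
  3                                     ∎
  where open ≤-Reasoning

∈-allSubsets : ∀ (p : Subset n) → p ∈ₗ allSubsets n
∈-allSubsets []                  = here refl
∈-allSubsets {suc n} (false ∷ p) = ∈-++⁺ˡ (∈-map⁺ (false ∷_) (∈-allSubsets p))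
∈-allSubsets {suc n} (true ∷ p)  = ∈-++⁺ʳ (map (false ∷_) (allSubsets n)) (∈-map⁺ (true ∷_) (∈-allSubsets p))

module _ {A : Set} (f : A → ℕ) where

  ∈⇒≤foldr-⊔ : ∀ {x xs} → x ∈ₗ xs → f x ≤ foldr (λ y acc → f y ⊔ acc) 0 xs
  ∈⇒≤foldr-⊔ {xs = y List.∷ ys} (here refl)  = m≤m⊔n (f y) _
  ∈⇒≤foldr-⊔ {xs = y List.∷ ys} (there x∈ys) = m≤n⇒m≤o⊔n (f y) (∈⇒≤foldr-⊔ x∈ys)

  foldr-⊔-attained : ∀ xs → let m = foldr (λ y acc → f y ⊔ acc) 0 xs in m ≡ 0 ⊎ ∃ λ x → f x ≡ m
  foldr-⊔-attained List.[]         = inj₁ refl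
  foldr-⊔-attained (y List.∷ ys) with ⊔-sel (f y) (foldr (λ y acc → f y ⊔ acc) 0 ys)
  ... | inj₁ m≡fy = inj₂ (y , sym m≡fy)
  ... | inj₂ m≡rest with foldr-⊔-attained ys
  ...   | inj₁ rest≡0          = inj₁ (trans m≡rest rest≡0)
  ...   | inj₂ (x , fx≡rest)   = inj₂ (x , trans fx≡rest (sym m≡rest))

restrict-indep⁺ : ∀ (G : SetSystem n) {X I} → Indep G I → I ⊆ X → Indep (restrict G X) I
restrict-indep⁺ G {X} {I} hI I⊆X with I ⊆? X
... | yes _    = cong₂ _∧_ hI refl
... | no I⊈X  = contradiction (λ {x} → I⊆X {x}) I⊈X

restrict-indep⁻ : ∀ (G : SetSystem n) {X I} → Indep (restrict G X) I → Indep G I × I ⊆ X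
restrict-indep⁻ G {X} {I} h with indep G I | I ⊆? X
restrict-indep⁻ G refl | true | yes I⊆X = refl , I⊆X

restrict-isMatroid : ∀ {G : SetSystem n} → IsMatroid G → ∀ X → IsMatroid (restrict G X)
restrict-isMatroid {G = G} isMatroid X = record
  { indep⊆ground = λ I hI → proj₂ (restrict-indep⁻ G hI)
  ; indep-∅      = restrict-indep⁺ G indep-∅ ⊥⊆
  ; hereditary   = λ I J I⊆J hJ → let (hJ , J⊆X) = restrict-indep⁻ G hJ in
                   restrict-indep⁺ G (hereditary I J I⊆J hJ) (⊆-trans I⊆J J⊆X)
  ; exchange     = λ I J hI hJ ∣I∣<∣J∣ →
      let (hI , I⊆X) = restrict-indep⁻ G hI
          (hJ , J⊆X) = restrict-indep⁻ G hJ
          (x , x∈J , x∉I , hIx) = exchange I J hI hJ ∣I∣<∣J∣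
      in x , x∈J , x∉I , restrict-indep⁺ G hIx (∪-least I⊆X (x∈p⇒⁅x⁆⊆p (J⊆X x∈J)))
  }
  where open IsMatroid isMatroid

truncation-indep : ∀ {H H' : SetSystem n} {I} → SameTruncation3 H H' → ∣ I ∣ ≤ 3 → Indep H I → Indep H' I
truncation-indep {H' = H'} {I} same ∣I∣≤3 hI =
  ∧-conicalˡ (indep H' I) _ (trans (sym (same I)) (cong₂ _∧_ hI (Equivalence.to T-≡ (≤⇒≤ᵇ ∣I∣≤3))))

pair-indep : ∀ {G : SetSystem n} {i j} → NoLoops G → NoMultiplePoints G →
             i ∈ ground G → j ∈ ground G → Indep G (⁅ i ⁆ ∪ ⁅ j ⁆)
pair-indep {G = G} {i} {j} noLoops noMultiplePoints i∈E j∈E with i ≟ᶠ j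
... | yes refl = subst (Indep G) (sym (∪-idem ⁅ i ⁆)) (noLoops i i∈E)
... | no i≢j   = noMultiplePoints i j i∈E j∈E i≢j

_∈cl?[_]_ : ∀ (x : Fin n) M A → Dec (x ∈cl[ M ] A)
x ∈cl?[ M ] A = (x ∈? ground M) ×-dec (rk M (A ∪ ⁅ x ⁆) ≟ℕ rk M A)

closure : SetSystem n → Subset n → Subset n
closure M A = tabulate (λ x → does (x ∈cl?[ M ] A))

∈closure⁺ : ∀ {M : SetSystem n} {A x} → x ∈cl[ M ] A → x ∈ closure M A
∈closure⁺ {M = M} {A} {x} x∈cl =
  lookup⇒[]= x _ (trans (lookup∘tabulate _ x) (dec-true (x ∈cl?[ M ] A) x∈cl))

∈closure⁻ : ∀ {M : SetSystem n} {A x} → x ∈ closure M A → x ∈cl[ M ] A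
∈closure⁻ {M = M} {A} {x} x∈ =
  does≡true⇒ (x ∈cl?[ M ] A) (trans (sym (lookup∘tabulate _ x)) ([]=⇒lookup x∈))

module MatroidProperties {M : SetSystem n} (isMatroid : IsMatroid M) where
  open IsMatroid isMatroid

  private
    weight : Subset n → Subset n → ℕ
    weight A I = if indep M I ∧ ⌊ I ⊆? A ⌋ then ∣ I ∣ else 0

    weight-indep : ∀ {I A} → Indep M I → I ⊆ A → weight A I ≡ ∣ I ∣
    weight-indep {I} {A} hI I⊆A with I ⊆? A
    ... | yes _   rewrite hI = refl
    ... | no I⊈A  = contradiction (λ {x} → I⊆A {x}) I⊈A

  indep⇒∣∣≤rk : ∀ {I A} → Indep M I → I ⊆ A → ∣ I ∣ ≤ rk M A
  indep⇒∣∣≤rk {I} {A} hI I⊆A =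
    subst (_≤ rk M A) (weight-indep hI I⊆A) (∈⇒≤foldr-⊔ (weight A) (∈-allSubsets I))

  rk≡0⇒basis-⊥ : ∀ {A} → rk M A ≡ 0 → IsBasisOf M ⊥ A
  rk≡0⇒basis-⊥ rk≡0 = indep-∅ , ⊥⊆ , trans (∣⊥∣≡0 n) (sym rk≡0)

  basis-exists : ∀ A → ∃ λ B → IsBasisOf M B A
  basis-exists A with foldr-⊔-attained (weight A) (allSubsets n)
  ... | inj₁ rk≡0 = ⊥ , rk≡0⇒basis-⊥ rk≡0
  ... | inj₂ (I , wI≡rk) with indep M I in hI | I ⊆? A
  ...   | true  | yes I⊆A = I , hI , I⊆A , wI≡rk
  ...   | true  | no _    = ⊥ , rk≡0⇒basis-⊥ (sym wI≡rk)
  ...   | false | _       = ⊥ , rk≡0⇒basis-⊥ (sym wI≡rk)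

  rk≤∣∣ : ∀ A → rk M A ≤ ∣ A ∣
  rk≤∣∣ A with basis-exists A
  ... | B , _ , B⊆A , ∣B∣≡rk = subst (_≤ ∣ A ∣) ∣B∣≡rk (p⊆q⇒∣p∣≤∣q∣ B⊆A)

  rk-mono : ∀ {A C} → A ⊆ C → rk M A ≤ rk M C
  rk-mono {A} A⊆C with basis-exists A
  ... | B , hB , B⊆A , ∣B∣≡rk = subst (_≤ _) ∣B∣≡rk (indep⇒∣∣≤rk hB (⊆-trans B⊆A A⊆C))

  ∣∣≤rk⇒indep : ∀ {I} → ∣ I ∣ ≤ rk M I → Indep M I
  ∣∣≤rk⇒indep {I} ∣I∣≤rk with basis-exists I
  ... | B , hB , B⊆I , ∣B∣≡rk =
    hereditary I B (p⊆q⇒∣q∣≤∣p∣⇒q⊆p B⊆I (subst (∣ I ∣ ≤_) (sym ∣B∣≡rk) ∣I∣≤rk)) hB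

  rk≤∣∣⇒basis : ∀ {J A} → Indep M J → J ⊆ A → rk M A ≤ ∣ J ∣ → IsBasisOf M J A
  rk≤∣∣⇒basis hJ J⊆A rk≤∣J∣ = hJ , J⊆A , ≤-antisym (indep⇒∣∣≤rk hJ J⊆A) rk≤∣J∣

  indep⇒basis : ∀ {I} → Indep M I → IsBasisOf M I I
  indep⇒basis {I} hI = rk≤∣∣⇒basis hI ⊆-refl (rk≤∣∣ I)

  maximal⇒basis : ∀ {K A} → Indep M K → K ⊆ A →
                  (∀ {y} → y ∈ A → Indep M (K ∪ ⁅ y ⁆) → y ∈ K) → IsBasisOf M K A
  maximal⇒basis {K} {A} hK K⊆A maximal with basis-exists A
  ... | L , hL , L⊆A , ∣L∣≡rk =
    hK , K⊆A , ≤-antisym (indep⇒∣∣≤rk hK K⊆A) (subst (_≤ ∣ K ∣) ∣L∣≡rk ∣L∣≤∣K∣)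
    where
    ∣L∣≤∣K∣ : ∣ L ∣ ≤ ∣ K ∣
    ∣L∣≤∣K∣ with ∣ L ∣ ≤? ∣ K ∣
    ... | yes ∣L∣≤∣K∣ = ∣L∣≤∣K∣
    ... | no ∣L∣≰∣K∣ with exchange K L hK hL (≰⇒> ∣L∣≰∣K∣)
    ...   | y , y∈L , y∉K , hKy = contradiction (maximal (L⊆A y∈L) hKy) y∉K

  indep-∪⁅y⁆-rk-bounded⇒y∈ : ∀ {K C y} → Indep M (K ∪ ⁅ y ⁆) → K ∪ ⁅ y ⁆ ⊆ C → rk M C ≤ ∣ K ∣ → y ∈ K
  indep-∪⁅y⁆-rk-bounded⇒y∈ {K} {y = y} hKy K∪y⊆C rk≤∣K∣ with y ∈? K
  ... | yes y∈K = y∈K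
  ... | no y∉K  = contradiction (x∉p⇒∣p∣<∣p∪⁅x⁆∣ y∉K) (≤⇒≯ (≤-trans (indep⇒∣∣≤rk hKy K∪y⊆C) rk≤∣K∣))

  basis-maximal : ∀ {K A y} → IsBasisOf M K A → y ∈ A → Indep M (K ∪ ⁅ y ⁆) → y ∈ K
  basis-maximal (_ , K⊆A , ∣K∣≡rk) y∈A hKy =
    indep-∪⁅y⁆-rk-bounded⇒y∈ hKy (∪-least K⊆A (x∈p⇒⁅x⁆⊆p y∈A)) (≤-reflexive (sym ∣K∣≡rk))

  basis-extend : ∀ {J A} → Indep M J → J ⊆ A → ∃ λ K → J ⊆ K × IsBasisOf M K A
  basis-extend {J} {A} hJ J⊆A = extend (rk M A) hJ J⊆A (m≤n+m (rk M A) ∣ J ∣)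
    where
    extend : ∀ k {J} → Indep M J → J ⊆ A → rk M A ≤ ∣ J ∣ + k → ∃ λ K → J ⊆ K × IsBasisOf M K A
    extend k {J} hJ J⊆A rk≤∣J∣+k with basis-exists A
    ... | L , hL , L⊆A , ∣L∣≡rk with ∣ L ∣ ≤? ∣ J ∣
    ...   | yes ∣L∣≤∣J∣ = J , ⊆-refl , rk≤∣∣⇒basis hJ J⊆A (subst (_≤ ∣ J ∣) ∣L∣≡rk ∣L∣≤∣J∣)
    ...   | no ∣L∣≰∣J∣ with exchange J L hJ hL (≰⇒> ∣L∣≰∣J∣) | k
    ...     | _ , _ , _ , _ | zero =
      contradiction (subst (∣ J ∣ <_) ∣L∣≡rk (≰⇒> ∣L∣≰∣J∣))
                    (≤⇒≯ (subst (rk M A ≤_) (+-identityʳ ∣ J ∣) rk≤∣J∣+k))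
    ...     | y , y∈L , y∉J , hJy | suc k
      with extend k hJy (∪-least J⊆A (x∈p⇒⁅x⁆⊆p (L⊆A y∈L)))
                  (≤-trans rk≤∣J∣+k (≤-trans (≤-reflexive (+-suc ∣ J ∣ k))
                                             (+-monoˡ-≤ k (x∉p⇒∣p∣<∣p∪⁅x⁆∣ y∉J))))
    ...       | K , J∪y⊆K , K-basis = K , ⊆-trans (p⊆p∪q ⁅ y ⁆) J∪y⊆K , K-basis

  ∈cl⁺ : ∀ {K A x} → IsBasisOf M K A → x ∈ ground M → (Indep M (K ∪ ⁅ x ⁆) → x ∈ K) → x ∈cl[ M ] A
  ∈cl⁺ {K} {A} {x} K-basis@(hK , K⊆A , ∣K∣≡rk) x∈E x-maximal =
    x∈E , trans (sym ∣K∣≡rk[A∪x]) ∣K∣≡rk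
    where
    maximal : ∀ {y} → y ∈ A ∪ ⁅ x ⁆ → Indep M (K ∪ ⁅ y ⁆) → y ∈ K
    maximal {y} y∈A∪x hKy with x∈p∪q⁻ A ⁅ x ⁆ y∈A∪x
    ... | inj₁ y∈A  = basis-maximal K-basis y∈A hKy
    ... | inj₂ y∈⁅x⁆ rewrite x∈⁅y⁆⇒x≡y x y∈⁅x⁆ = x-maximal hKy
    ∣K∣≡rk[A∪x] : ∣ K ∣ ≡ rk M (A ∪ ⁅ x ⁆)
    ∣K∣≡rk[A∪x] = proj₂ (proj₂ (maximal⇒basis hK (⊆-trans K⊆A (p⊆p∪q ⁅ x ⁆)) maximal))

  ∈cl⁻ : ∀ {K A x} → IsBasisOf M K A → x ∈cl[ M ] A → Indep M (K ∪ ⁅ x ⁆) → x ∈ K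
  ∈cl⁻ {K} {A} {x} (_ , K⊆A , ∣K∣≡rk) (_ , rk[A∪x]≡rk) hKx =
    indep-∪⁅y⁆-rk-bounded⇒y∈ hKx (∪-least (⊆-trans K⊆A (p⊆p∪q ⁅ x ⁆)) (q⊆p∪q A ⁅ x ⁆))
                             (≤-reflexive (trans rk[A∪x]≡rk (sym ∣K∣≡rk)))

  cl-mono : ∀ {A C x} → A ⊆ C → x ∈cl[ M ] A → x ∈cl[ M ] C
  cl-mono {A} {x = x} A⊆C x∈clA with basis-exists A
  ... | K , K-basis@(hK , K⊆A , _) with basis-extend hK (⊆-trans K⊆A A⊆C)
  ...   | K' , K⊆K' , K'-basis = ∈cl⁺ K'-basis (proj₁ x∈clA) λ hK'x →
    K⊆K' (∈cl⁻ K-basis x∈clA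
            (hereditary _ _ (∪-least (⊆-trans K⊆K' (p⊆p∪q ⁅ x ⁆)) (q⊆p∪q K' ⁅ x ⁆)) hK'x))

  basis-closure : ∀ {K A} → IsBasisOf M K A → IsBasisOf M K (closure M A)
  basis-closure {K} {A} K-basis@(hK , _ , _) = maximal⇒basis hK K⊆closure
    (λ y∈closure hKy → ∈cl⁻ K-basis (∈closure⁻ y∈closure) hKy)
    where
    K⊆closure : K ⊆ closure M A
    K⊆closure k∈K = ∈closure⁺ (∈cl⁺ K-basis (indep⊆ground K hK k∈K) (λ _ → k∈K))

  rk-closure : ∀ A → rk M (closure M A) ≡ rk M A
  rk-closure A with basis-exists A
  ... | K , K-basis = trans (sym (proj₂ (proj₂ (basis-closure K-basis)))) (proj₂ (proj₂ K-basis))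

  closure-flat : ∀ A → Flat M (closure M A)
  closure-flat A with basis-exists A
  ... | K , K-basis = (λ x∈ → proj₁ (∈closure⁻ x∈)) , λ x x∈cl →
    ∈closure⁺ (∈cl⁺ K-basis (proj₁ x∈cl) (∈cl⁻ (basis-closure K-basis) x∈cl))

  ⊆closure : ∀ {A} → A ⊆ ground M → A ⊆ closure M A
  ⊆closure A⊆E x∈A = ∈closure⁺
    (A⊆E x∈A , ≤-antisym (rk-mono (∪-least ⊆-refl (x∈p⇒⁅x⁆⊆p x∈A))) (rk-mono (p⊆p∪q _)))

  closure-least : ∀ {F A x} → Flat M F → A ⊆ F → x ∈cl[ M ] A → x ∈ F
  closure-least (_ , closed) A⊆F x∈clA = closed _ (cl-mono A⊆F x∈clA)

module _ {H H' : SetSystem n} (isMatroidH : IsMatroid H) (isMatroidH' : IsMatroid H') where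
  private
    module H  = MatroidProperties isMatroidH
    module H' = MatroidProperties isMatroidH'

  quotient⇒indep : IsQuotientOf H H' → ∀ {I} → Indep H I → Indep H' I
  quotient⇒indep quotient {I} hI with H'.basis-exists I
  ... | J , J-basis@(hJ , J⊆I , ∣J∣≡rk') = H'.∣∣≤rk⇒indep (begin
    ∣ I ∣               ≤⟨ H.indep⇒∣∣≤rk hI I⊆closureJ ⟩
    rk H (closure H J)  ≡⟨ H.rk-closure J ⟩
    rk H J              ≤⟨ H.rk≤∣∣ J ⟩
    ∣ J ∣               ≡⟨ ∣J∣≡rk' ⟩
    rk H' I             ∎)
    where
    open ≤-Reasoning
    I⊆E : I ⊆ ground H
    I⊆E = IsMatroid.indep⊆ground isMatroidH I hI
    E⊆E' : ground H ⊆ ground H'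
    E⊆E' = proj₁ (quotient (ground H) ((λ x∈E → x∈E) , λ _ x∈cl → proj₁ x∈cl))
    I⊆closureJ : I ⊆ closure H J
    I⊆closureJ x∈I = H'.closure-least (quotient _ (H.closure-flat J)) (H.⊆closure (⊆-trans J⊆I I⊆E))
                       (H'.∈cl⁺ (H'.indep⇒basis hJ) (E⊆E' (I⊆E x∈I)) (H'.basis-maximal J-basis x∈I))

module _ {G : SetSystem n} (isMatroidG : IsMatroid G)
         (noLoops : NoLoops G) (noMultiplePoints : NoMultiplePoints G)
         {X : Subset n} (flatX : Flat G X)
         {H' : SetSystem n} (isMatroidH' : IsMatroid H') (ground≡X : ground H' ≡ X)
         (sameTruncation : SameTruncation3 (restrict G X) H') where
  private
    module G  = MatroidProperties isMatroidG
    module H' = MatroidProperties isMatroidH'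

    X⊆E : X ⊆ ground G
    X⊆E = proj₁ flatX

    closure'⊆X : ∀ {B} → closure H' B ⊆ X
    closure'⊆X x∈ = subst (_ ∈_) ground≡X (proj₁ (∈closure⁻ x∈))

  closure'-lineClosed : ∀ B → LineClosed G (closure H' B)
  closure'-lineClosed B i j i∈T j∈T x x∈clP = H'.closure-least (H'.closure-flat B) P⊆T x∈cl'P
    where
    P : Subset n
    P = ⁅ i ⁆ ∪ ⁅ j ⁆
    P⊆T : P ⊆ closure H' B
    P⊆T = ∪-least (x∈p⇒⁅x⁆⊆p i∈T) (x∈p⇒⁅x⁆⊆p j∈T)
    P⊆X : P ⊆ X
    P⊆X = ⊆-trans P⊆T closure'⊆X
    ∣P∪x∣≤3 : ∣ P ∪ ⁅ x ⁆ ∣ ≤ 3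
    ∣P∪x∣≤3 = ∣⁅i⁆∪⁅j⁆∪⁅k⁆∣≤3 i j x
    hP : Indep G P
    hP = pair-indep {G = G} noLoops noMultiplePoints (X⊆E (closure'⊆X i∈T)) (X⊆E (closure'⊆X j∈T))
    hP' : Indep H' P
    hP' = truncation-indep {H = restrict G X} {H'} sameTruncation
            (≤-trans (p⊆q⇒∣p∣≤∣q∣ (p⊆p∪q {p = P} ⁅ x ⁆)) ∣P∪x∣≤3) (restrict-indep⁺ G hP P⊆X)
    x∈cl'P : x ∈cl[ H' ] P
    x∈cl'P = H'.∈cl⁺ (H'.indep⇒basis hP')
               (subst (x ∈_) (sym ground≡X) (G.closure-least flatX P⊆X x∈clP))
               λ hP∪x' → G.∈cl⁻ (G.indep⇒basis hP) x∈clP (proj₁ (restrict-indep⁻ G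
                 (truncation-indep {H = H'} {restrict G X} (λ I → sym (sameTruncation I)) ∣P∪x∣≤3 hP∪x')))

  indep'⇒restrict-indep : (∀ Y → Flat G Y → ∃ λ B → IsBasisOf G B Y × LineClosureIs G B Y) →
                          ∀ {I} → Indep H' I → Indep (restrict G X) I
  indep'⇒restrict-indep lineBases {I} hI' with lineBases (closure G I) (G.closure-flat I)
  ... | B , (_ , B⊆Y , ∣B∣≡rkY) , B-lineSpans = restrict-indep⁺ G (G.∣∣≤rk⇒indep (begin
    ∣ I ∣                 ≤⟨ H'.indep⇒∣∣≤rk hI' (⊆-trans (G.⊆closure (⊆-trans I⊆X X⊆E)) Y⊆T) ⟩
    rk H' (closure H' B)  ≡⟨ H'.rk-closure B ⟩
    rk H' B               ≤⟨ H'.rk≤∣∣ B ⟩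
    ∣ B ∣                 ≡⟨ ∣B∣≡rkY ⟩
    rk G (closure G I)    ≡⟨ G.rk-closure I ⟩
    rk G I                ∎)) I⊆X
    where
    open ≤-Reasoning
    I⊆X : I ⊆ X
    I⊆X x∈I = subst (_ ∈_) ground≡X (IsMatroid.indep⊆ground isMatroidH' I hI' x∈I)
    B⊆E' : B ⊆ ground H'
    B⊆E' x∈B = subst (_ ∈_) (sym ground≡X) (G.closure-least flatX I⊆X (∈closure⁻ (B⊆Y x∈B)))
    Y⊆T : closure G I ⊆ closure H' B
    Y⊆T y∈Y = proj₁ (B-lineSpans _) y∈Y (closure H' B) (⊆-trans closure'⊆X X⊆E)
                                       (closure'-lineClosed B) (H'.⊆closure B⊆E')

corollary3p12 : (n : ℕ) (G : SetSystem n) → IsMatroid G → ground G ≡ ⊤ →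
                NoLoops G → NoMultiplePoints G →
                (∀ X → Flat G X → ∃ λ B → IsBasisOf G B X × LineClosureIs G B X) →
                LocallyTaut G
corollary3p12 n G isMatroidG _ noLoops noMultiplePoints lineBases
              X flatX H' isMatroidH' ground≡X quotient sameTruncation I =
  ≡true-equiv⇒≡ (quotient⇒indep (restrict-isMatroid isMatroidG X) isMatroidH' quotient)
                (indep'⇒restrict-indep isMatroidG noLoops noMultiplePoints flatX
                                       isMatroidH' ground≡X sameTruncation lineBases)
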